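{- Let $N = q^k n^2$ be an odd perfect number given in Eulerian form. Define $G = \gcd(\sigma(q^k),\sigma(n^2))$ and $I = \gcd(n,\sigma(n^2))$. Then $$I = \frac{n}{\sigma(q^k)/2}\cdot \gcd\big(\sigma(q^k)/2,\, n\big) \quad\text{and}\quad G = \frac{\big(\gcd(\sigma(q^k)/2,\, n)\big)^2}{\sigma(q^k)/2}.$$
   Context: $\sigma(x)$ denotes the sum of the positive divisors of $x$. A positive integer $N$ is perfect if $\sigma(N)=2N$. An odd perfect number $N$ is said to be given in Eulerian form $N = q^k n^2$ if $q$ is a prime (the special prime), $k$ and $n$ are positive integers, $q \equiv k \equiv 1 \pmod 4$, and $\gcd(q,n)=1$. -}

module Defs where

open import Data.Nat using (ℕ; zero; suc; _+_; _*_; _^_; _%_; _/_)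
open import Data.Nat.Divisibility using (_∣_; _∣?_)
open import Data.Nat.Primality using (Prime)
open import Data.Nat.GCD using (gcd)
open import Data.List using (List; filter; upTo; map)
open import Data.Nat.ListAction using (sum)
open import Data.Product using (_×_)
open import Relation.Binary.PropositionalEquality using (_≡_)

σ : ℕ → ℕ
σ x = sum (filter (_∣? x) (map suc (upTo x)))

Perfect : ℕ → Set
Perfect N = σ N ≡ 2 * N

-- Natural-number division (quotient); only used where the division is exact
-- and the divisor is positive (division by zero returns 0 by convention).
_÷_ : ℕ → ℕ → ℕ
m ÷ zero = 0
m ÷ suc d = m / suc d

EulerianOPN : ℕ → ℕ → ℕ → ℕ → Set
EulerianOPN N q k n =
  (N % 2 ≡ 1) × Perfect N × (N ≡ q ^ k * n ^ 2) × Prime q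
  × (q % 4 ≡ 1) × (k % 4 ≡ 1) × (gcd q n ≡ 1)

-- Multiplicativity of σ turns σ N = 2N into σ(q^k) σ(n²) = 2 q^k n². Since q ≡ k ≡ 1 (mod 4), the
-- sum σ(q^k) = 1 + q + ⋯ + q^k has k + 1 odd terms, so it is 2s for some s; and s, dividing a number
-- ≡ 1 (mod q), is coprime to q^k. From s σ(n²) = q^k n² we get n² = s m and σ(n²) = q^k m. As n and
-- the odd σ(n²) are coprime to q^k and to 2 respectively, I = gcd(n, m) and G = gcd(s, m), while
-- s gcd(n, m) = gcd(sn, n²) = n gcd(s, n) and s gcd(s, m) = gcd(s², n²) = gcd(s, n)².

module Submission where

open import Data.List using (List; []; _∷_; _++_; map; filter; upTo; cartesianProductWith)
open import Data.List.Membership.Propositional using (_∈_)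
open import Data.List.Membership.Propositional.Properties
open import Data.List.Membership.Propositional.Properties.WithK using (unique∧set⇒bag)
open import Data.List.Relation.Binary.BagAndSetEquality using (∼bag⇒↭)
open import Data.List.Relation.Binary.Disjoint.Propositional using (Disjoint)
import Data.List.Relation.Unary.All as All
import Data.List.Relation.Unary.All.Properties as All
open import Data.List.Relation.Unary.AllPairs using ([]; _∷_)
open import Data.List.Relation.Unary.Any using (here; there)
open import Data.List.Relation.Unary.Unique.Propositional using (Unique)
import Data.List.Relation.Unary.Unique.Propositional.Properties as Unique
open import Data.Nat
open import Data.Nat.Coprimality as Coprime using (Coprime; coprime-divisor; coprime-factors; 1-coprimeTo)
open import Data.Nat.DivMod
open import Data.Nat.Divisibility
open import Data.Nat.GCD
open import Data.Nat.LCM using (lcm; lcm-least; gcd*lcm)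
open import Data.Nat.ListAction using (sum)
open import Data.Nat.ListAction.Properties using (sum-↭; sum-++)
open import Data.Nat.Primality using (Prime; prime⇒irreducible; prime⇒nonZero; prime⇒nonTrivial)
open import Data.Nat.Properties
open import Algebra.Properties.CommutativeSemiring.Exp +-*-commutativeSemiring using (^-distrib-*)
open import Data.Nat.Tactic.RingSolver using (solve-∀)
open import Data.Product using (_×_; _,_; proj₁; proj₂; ∃-syntax)
open import Data.Sum using (inj₁; inj₂)
open import Function using (id; _∘_; _⇔_; mk⇔)
open import Function.Properties.Equivalence using () renaming (trans to ⇔-trans; sym to ⇔-sym)
open import Relation.Binary.PropositionalEquality
open import Relation.Nullary using (¬_; yes; no; contradiction)
open import Defs

module _ {A B : Set} where

  Unique-map : ∀ {f : A → B} {xs} → (∀ {x y} → x ∈ xs → y ∈ xs → f x ≡ f y → x ≡ y) →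
               Unique xs → Unique (map f xs)
  Unique-map inj []         = []
  Unique-map inj (x∉ ∷ xs!) =
    All.map⁺ (All.tabulate λ y∈ fx≡fy → All.lookup x∉ y∈ (inj (here refl) (there y∈) fx≡fy))
    ∷ Unique-map (λ x∈ y∈ → inj (there x∈) (there y∈)) xs!

module _ {A B C : Set} (f : A → B → C) where

  Unique-cartesianProductWith : ∀ {xs ys} →
    (∀ {w x y z} → w ∈ xs → x ∈ xs → y ∈ ys → z ∈ ys → f w y ≡ f x z → w ≡ x × y ≡ z) →
    Unique xs → Unique ys → Unique (cartesianProductWith f xs ys)
  Unique-cartesianProductWith {[]}     inj xs!        ys! = []
  Unique-cartesianProductWith {x ∷ xs} {ys} inj (x∉ ∷ xs!) ys! = Unique.++⁺
    (Unique-map (λ y∈ z∈ → proj₂ ∘ inj (here refl) (here refl) y∈ z∈) ys!)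
    (Unique-cartesianProductWith (λ w∈ x∈ → inj (there w∈) (there x∈)) xs! ys!)
    disjoint
    where
    disjoint : Disjoint (map (f x) ys) (cartesianProductWith f xs ys)
    disjoint (v∈ , v∈′) with ∈-map⁻ (f x) v∈ | ∈-cartesianProductWith⁻ f xs ys v∈′
    ... | y , y∈ , refl | w , z , w∈ , z∈ , fxy≡fwz =
      All.lookup x∉ w∈ (proj₁ (inj (here refl) (there w∈) y∈ z∈ fxy≡fwz))

sum-map-* : ∀ m ns → sum (map (m *_) ns) ≡ m * sum ns
sum-map-* m []       = sym (*-zeroʳ m)
sum-map-* m (n ∷ ns) = begin
  m * n + sum (map (m *_) ns) ≡⟨ cong (m * n +_) (sum-map-* m ns) ⟩
  m * n + m * sum ns          ≡⟨ *-distribˡ-+ m n (sum ns) ⟨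
  m * (n + sum ns)            ∎
  where open ≡-Reasoning

sum-cartesianProductWith-* : ∀ ms ns → sum (cartesianProductWith _*_ ms ns) ≡ sum ms * sum ns
sum-cartesianProductWith-* []       ns = refl
sum-cartesianProductWith-* (m ∷ ms) ns = begin
  sum (map (m *_) ns ++ cartesianProductWith _*_ ms ns)
    ≡⟨ sum-++ (map (m *_) ns) _ ⟩
  sum (map (m *_) ns) + sum (cartesianProductWith _*_ ms ns)
    ≡⟨ cong₂ _+_ (sum-map-* m ns) (sum-cartesianProductWith-* ms ns) ⟩
  m * sum ns + sum ms * sum ns
    ≡⟨ *-distribʳ-+ (sum ns) m (sum ms) ⟨
  (m + sum ms) * sum ns ∎
  where open ≡-Reasoning

coprime-∣ˡ : ∀ {m n d} → Coprime m n → d ∣ m → Coprime d n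
coprime-∣ˡ m⊥n d∣m (i∣d , i∣n) = m⊥n (∣-trans i∣d d∣m , i∣n)

coprime-∣ʳ : ∀ {m n d} → Coprime m n → d ∣ n → Coprime m d
coprime-∣ʳ m⊥n d∣n = Coprime.sym (coprime-∣ˡ (Coprime.sym m⊥n) d∣n)

coprime-*ʳ : ∀ {m n o} → Coprime m n → Coprime m o → Coprime m (n * o)
coprime-*ʳ {o = o} m⊥n m⊥o (i∣m , i∣no) =
  m⊥o (i∣m , coprime-factors m⊥n (∣m⇒∣m*n o i∣m , i∣no))

coprime-^ʳ : ∀ {m n} → Coprime m n → ∀ k → Coprime m (n ^ k)
coprime-^ʳ m⊥n zero    = Coprime.sym (1-coprimeTo _)
coprime-^ʳ m⊥n (suc k) = coprime-*ʳ m⊥n (coprime-^ʳ m⊥n k)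

coprime-^ˡ : ∀ {m n} → Coprime m n → ∀ k → Coprime (m ^ k) n
coprime-^ˡ m⊥n k = Coprime.sym (coprime-^ʳ (Coprime.sym m⊥n) k)

coprime⇒*∣ : ∀ {m n o} → Coprime m n → m ∣ o → n ∣ o → m * n ∣ o
coprime⇒*∣ {m} {n} m⊥n m∣o n∣o = subst (_∣ _) lcm≡m*n (lcm-least m∣o n∣o)
  where
  lcm≡m*n : lcm m n ≡ m * n
  lcm≡m*n = begin
    lcm m n            ≡⟨ *-identityˡ (lcm m n) ⟨
    1 * lcm m n        ≡⟨ cong (_* lcm m n) (Coprime.coprime⇒gcd≡1 m⊥n) ⟨
    gcd m n * lcm m n  ≡⟨ gcd*lcm m n ⟩
    m * n              ∎
    where open ≡-Reasoning

coprime-1+m*n : ∀ m n → Coprime (1 + m * n) m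
coprime-1+m*n m n {i} (i∣1+mn , i∣m) =
  ∣1⇒≡1 (∣m+n∣m⇒∣n (subst (i ∣_) (+-comm 1 (m * n)) i∣1+mn) (∣m⇒∣m*n n i∣m))

m%n≡1⇒coprime : ∀ {m n} .{{_ : NonZero n}} → m % n ≡ 1 → Coprime m n
m%n≡1⇒coprime m%n≡1 (i∣m , i∣n) = ∣1⇒≡1 (subst (_ ∣_) m%n≡1 (%-presˡ-∣ i∣m i∣n))

coprime∧*≡*⇒∃ : ∀ {s t x y} .{{_ : NonZero s}} → Coprime s t → s * x ≡ t * y →
                ∃[ m ] s * m ≡ y × x ≡ t * m
coprime∧*≡*⇒∃ {s} {t} {x} {y} s⊥t s*x≡t*y = m , s*m≡y , x≡t*m
  where
  open ≡-Reasoning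
  s∣y : s ∣ y
  s∣y = coprime-divisor s⊥t (divides x (trans (sym s*x≡t*y) (*-comm s x)))
  m = quotient s∣y
  s*m≡y : s * m ≡ y
  s*m≡y = sym (m∣n⇒n≡m*quotient s∣y)
  x≡t*m : x ≡ t * m
  x≡t*m = *-cancelˡ-≡ x (t * m) s (begin
    s * x        ≡⟨ s*x≡t*y ⟩
    t * y        ≡⟨ cong (t *_) s*m≡y ⟨
    t * (s * m)  ≡⟨ *-assoc t s m ⟨
    t * s * m    ≡⟨ cong (_* m) (*-comm t s) ⟩
    s * t * m    ≡⟨ *-assoc s t m ⟩
    s * (t * m)  ∎)

gcd[m*n,o]≡m : ∀ {m n o} → m ∣ o → Coprime n o → gcd (m * n) o ≡ m
gcd[m*n,o]≡m {m} {n} {o} m∣o n⊥o = ∣-antisym g∣m (gcd-greatest (m∣m*n n) m∣o)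
  where
  g∣m : gcd (m * n) o ∣ m
  g∣m = coprime-divisor (coprime-∣ˡ (Coprime.sym n⊥o) (gcd[m,n]∣n (m * n) o))
          (subst (gcd (m * n) o ∣_) (*-comm m n) (gcd[m,n]∣m (m * n) o))

gcd[m,n*o]≡gcd[m,o] : ∀ {m n} o → Coprime m n → gcd m (n * o) ≡ gcd m o
gcd[m,n*o]≡gcd[m,o] {m} {n} o m⊥n = ∣-antisym
  (gcd-greatest (gcd[m,n]∣m m (n * o))
    (coprime-divisor (coprime-∣ˡ m⊥n (gcd[m,n]∣m m (n * o))) (gcd[m,n]∣n m (n * o))))
  (gcd-greatest (gcd[m,n]∣m m o) (∣n⇒∣m*n n (gcd[m,n]∣n m o)))

m^2≡m*m : ∀ m → m ^ 2 ≡ m * m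
m^2≡m*m m = cong (m *_) (*-identityʳ m)

gcd[m^2,n^2]≡gcd[m,n]^2 : ∀ m n → gcd (m ^ 2) (n ^ 2) ≡ gcd m n ^ 2
gcd[m^2,n^2]≡gcd[m,n]^2 zero    n = trans (gcd-identityˡ (n ^ 2)) (cong (_^ 2) (sym (gcd-identityˡ n)))
gcd[m^2,n^2]≡gcd[m,n]^2 m@(suc _) n = begin
  gcd (m ^ 2) (n ^ 2)
    ≡⟨ cong₂ (λ x y → gcd (x ^ 2) (y ^ 2)) (sym (m/n*n≡m g∣m)) (sym (m/n*n≡m g∣n)) ⟩
  gcd ((m′ * g) ^ 2) ((n′ * g) ^ 2)      ≡⟨ cong₂ gcd ([x*y]^2≡y^2*x^2 m′ g) ([x*y]^2≡y^2*x^2 n′ g) ⟩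
  gcd (g ^ 2 * m′ ^ 2) (g ^ 2 * n′ ^ 2)  ≡⟨ c*gcd[m,n]≡gcd[cm,cn] (g ^ 2) (m′ ^ 2) (n′ ^ 2) ⟨
  g ^ 2 * gcd (m′ ^ 2) (n′ ^ 2)          ≡⟨ cong (g ^ 2 *_) (Coprime.coprime⇒gcd≡1 m′²⊥n′²) ⟩
  g ^ 2 * 1                              ≡⟨ *-identityʳ (g ^ 2) ⟩
  g ^ 2                                  ∎
  where
  open ≡-Reasoning
  g = gcd m n
  instance
    g≢0 : NonZero g
    g≢0 = ≢-nonZero (gcd[m,n]≢0 m n (inj₁ (λ ())))
  g∣m = gcd[m,n]∣m m n
  g∣n = gcd[m,n]∣n m n
  m′ = m / g
  n′ = n / g
  m′²⊥n′² : Coprime (m′ ^ 2) (n′ ^ 2)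
  m′²⊥n′² = coprime-^ˡ (coprime-^ʳ (Coprime.coprime-/gcd m n) 2) 2
  [x*y]^2≡y^2*x^2 : ∀ x y → (x * y) ^ 2 ≡ y ^ 2 * x ^ 2
  [x*y]^2≡y^2*x^2 x y = trans (^-distrib-* x y 2) (*-comm (x ^ 2) (y ^ 2))

*≡⇒≡/ : ∀ {m n o} .{{_ : NonZero n}} → m * n ≡ o → m ≡ o / n
*≡⇒≡/ {m} {n} m*n≡o = trans (sym (m*n/n≡m m n)) (cong (_/ n) m*n≡o)

module _ {s m n : ℕ} .{{_ : NonZero s}} (s*m≡n^2 : s * m ≡ n ^ 2) where

  gcd[n,m]≡n*gcd[s,n]/s : gcd n m ≡ n * gcd s n / s
  gcd[n,m]≡n*gcd[s,n]/s = *≡⇒≡/ (begin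
    gcd n m * s          ≡⟨ *-comm (gcd n m) s ⟩
    s * gcd n m          ≡⟨ c*gcd[m,n]≡gcd[cm,cn] s n m ⟩
    gcd (s * n) (s * m)  ≡⟨ cong₂ gcd (*-comm s n) (trans s*m≡n^2 (m^2≡m*m n)) ⟩
    gcd (n * s) (n * n)  ≡⟨ c*gcd[m,n]≡gcd[cm,cn] n s n ⟨
    n * gcd s n          ∎)
    where open ≡-Reasoning

  gcd[s,m]≡gcd[s,n]^2/s : gcd s m ≡ gcd s n ^ 2 / s
  gcd[s,m]≡gcd[s,n]^2/s = *≡⇒≡/ (begin
    gcd s m * s          ≡⟨ *-comm (gcd s m) s ⟩
    s * gcd s m          ≡⟨ c*gcd[m,n]≡gcd[cm,cn] s s m ⟩
    gcd (s * s) (s * m)  ≡⟨ cong₂ gcd (sym (m^2≡m*m s)) s*m≡n^2 ⟩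
    gcd (s ^ 2) (n ^ 2)  ≡⟨ gcd[m^2,n^2]≡gcd[m,n]^2 s n ⟩
    gcd s n ^ 2          ∎)
    where open ≡-Reasoning

divisors : ℕ → List ℕ
divisors n = filter (_∣? n) (map suc (upTo n))

Unique-divisors : ∀ n → Unique (divisors n)
Unique-divisors n = Unique.filter⁺ (_∣? n) (Unique.map⁺ suc-injective (Unique.upTo⁺ n))

∈-divisors⁺ : ∀ {n d} .{{_ : NonZero n}} → d ∣ n → d ∈ divisors n
∈-divisors⁺ {n} {zero}  0∣n = contradiction (0∣⇒≡0 0∣n) (≢-nonZero⁻¹ n)
∈-divisors⁺ {n} {suc _} d∣n = ∈-filter⁺ (_∣? n) (∈-map⁺ suc (∈-upTo⁺ (∣⇒≤ d∣n))) d∣n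

∈-divisors⁻ : ∀ n {d} → d ∈ divisors n → d ∣ n
∈-divisors⁻ n = proj₂ ∘ ∈-filter⁻ (_∣? n) {xs = map suc (upTo n)}

∈-divisors : ∀ n {d} .{{_ : NonZero n}} → d ∈ divisors n ⇔ d ∣ n
∈-divisors n = mk⇔ (∈-divisors⁻ n) ∈-divisors⁺

σ≡sum : ∀ {n ds} .{{_ : NonZero n}} → Unique ds → (∀ {d} → d ∈ ds ⇔ d ∣ n) → σ n ≡ sum ds
σ≡sum {n} ds! ∈ds =
  sum-↭ (∼bag⇒↭ (unique∧set⇒bag (Unique-divisors n) ds! (⇔-trans (∈-divisors n) (⇔-sym ∈ds))))

module _ {a b : ℕ} (a⊥b : Coprime a b) where

  *-injective-on-divisors : ∀ {x x′ y y′} → x ∣ a → x′ ∣ a → y ∣ b → y′ ∣ b →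
                            x * y ≡ x′ * y′ → x ≡ x′ × y ≡ y′
  *-injective-on-divisors {x} {x′} {y} {y′} x∣a x′∣a y∣b y′∣b xy≡x′y′ =
      (begin
        x               ≡⟨ gcd[m*n,o]≡m x∣a (y⊥a y∣b) ⟨
        gcd (x * y) a   ≡⟨ cong (λ v → gcd v a) xy≡x′y′ ⟩
        gcd (x′ * y′) a ≡⟨ gcd[m*n,o]≡m x′∣a (y⊥a y′∣b) ⟩
        x′              ∎)
    , (begin
        y               ≡⟨ gcd[m*n,o]≡m y∣b (x⊥b x∣a) ⟨
        gcd (y * x) b   ≡⟨ cong (λ v → gcd v b) (*-comm y x) ⟩
        gcd (x * y) b   ≡⟨ cong (λ v → gcd v b) xy≡x′y′ ⟩
        gcd (x′ * y′) b ≡⟨ cong (λ v → gcd v b) (*-comm x′ y′) ⟩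
        gcd (y′ * x′) b ≡⟨ gcd[m*n,o]≡m y′∣b (x⊥b x′∣a) ⟩
        y′              ∎)
    where
    open ≡-Reasoning
    y⊥a : ∀ {y} → y ∣ b → Coprime y a
    y⊥a y∣b = Coprime.sym (coprime-∣ʳ a⊥b y∣b)
    x⊥b : ∀ {x} → x ∣ a → Coprime x b
    x⊥b = coprime-∣ˡ a⊥b

  gcd[z,a]*gcd[z,b]≡z : ∀ {z} → z ∣ a * b → gcd z a * gcd z b ≡ z
  gcd[z,a]*gcd[z,b]≡z {z} z∣ab = ∣-antisym
    (coprime⇒*∣ (coprime-∣ʳ (coprime-∣ˡ a⊥b (gcd[m,n]∣n z a)) (gcd[m,n]∣n z b))
                (gcd[m,n]∣m z a) (gcd[m,n]∣m z b))
    (subst (z ∣_) gcd[zg,ag]≡gcd[z,a]*g (gcd-greatest (m∣m*n g) z∣ag))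
    where
    open ≡-Reasoning
    g = gcd z b
    z∣ag : z ∣ a * g
    z∣ag = subst (z ∣_) (sym (c*gcd[m,n]≡gcd[cm,cn] a z b)) (gcd-greatest (n∣m*n a) z∣ab)
    gcd[zg,ag]≡gcd[z,a]*g : gcd (z * g) (a * g) ≡ gcd z a * g
    gcd[zg,ag]≡gcd[z,a]*g = begin
      gcd (z * g) (a * g) ≡⟨ cong₂ gcd (*-comm z g) (*-comm a g) ⟩
      gcd (g * z) (g * a) ≡⟨ c*gcd[m,n]≡gcd[cm,cn] g z a ⟨
      g * gcd z a         ≡⟨ *-comm g (gcd z a) ⟩
      gcd z a * g         ∎

-- σ 0 = 0, so when a factor is 0 the identity holds without coprimality.
σ-multiplicative : ∀ {a b} → Coprime a b → σ (a * b) ≡ σ a * σ b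
σ-multiplicative {zero}                  _   = refl
σ-multiplicative {a}         {zero}      _   = trans (cong σ (*-zeroʳ a)) (sym (*-zeroʳ (σ a)))
σ-multiplicative {a@(suc _)} {b@(suc _)} a⊥b = begin
  σ (a * b)
    ≡⟨ σ≡sum products! ∈products ⟩
  sum (cartesianProductWith _*_ (divisors a) (divisors b))
    ≡⟨ sum-cartesianProductWith-* (divisors a) (divisors b) ⟩
  σ a * σ b ∎
  where
  open ≡-Reasoning
  products! : Unique (cartesianProductWith _*_ (divisors a) (divisors b))
  products! = Unique-cartesianProductWith _*_
    (λ w∈ x∈ y∈ z∈ → *-injective-on-divisors a⊥b
      (∈-divisors⁻ a w∈) (∈-divisors⁻ a x∈) (∈-divisors⁻ b y∈) (∈-divisors⁻ b z∈))
    (Unique-divisors a) (Unique-divisors b)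
  ∈products⁻ : ∀ {d} → d ∈ cartesianProductWith _*_ (divisors a) (divisors b) → d ∣ a * b
  ∈products⁻ d∈ with ∈-cartesianProductWith⁻ _*_ (divisors a) (divisors b) d∈
  ... | x , y , x∈ , y∈ , refl = *-pres-∣ (∈-divisors⁻ a x∈) (∈-divisors⁻ b y∈)
  ∈products⁺ : ∀ {d} → d ∣ a * b → d ∈ cartesianProductWith _*_ (divisors a) (divisors b)
  ∈products⁺ {d} d∣ab = subst (_∈ _) (gcd[z,a]*gcd[z,b]≡z a⊥b d∣ab)
    (∈-cartesianProductWith⁺ _*_ (∈-divisors⁺ (gcd[m,n]∣n d a)) (∈-divisors⁺ (gcd[m,n]∣n d b)))
  ∈products : ∀ {d} → d ∈ cartesianProductWith _*_ (divisors a) (divisors b) ⇔ d ∣ a * b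
  ∈products = mk⇔ ∈products⁻ ∈products⁺

powers : ℕ → ℕ → List ℕ
powers p zero    = 1 ∷ []
powers p (suc k) = 1 ∷ map (p *_) (powers p k)

sum-powers-suc : ∀ p k → sum (powers p (suc k)) ≡ 1 + p * sum (powers p k)
sum-powers-suc p k = cong (1 +_) (sum-map-* p (powers p k))

∈-powers⁻ : ∀ {p} k {d} → d ∈ powers p k → d ∣ p ^ k
∈-powers⁻     zero    (here refl) = ∣-refl
∈-powers⁻     (suc k) (here refl) = 1∣ _
∈-powers⁻ {p} (suc k) (there d∈) with ∈-map⁻ (p *_) d∈
... | e , e∈ , refl = *-monoʳ-∣ p (∈-powers⁻ k e∈)

sum-powers-coprime : ∀ p k → Coprime (sum (powers p k)) p
sum-powers-coprime p zero    = 1-coprimeTo p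
sum-powers-coprime p (suc k) =
  subst (λ x → Coprime x p) (sym (sum-powers-suc p k)) (coprime-1+m*n p (sum (powers p k)))

sum-powers-odd : ∀ t k → ∃[ c ] sum (powers (1 + t * 2) k) ≡ suc k + c * 2
sum-powers-odd t zero    = 0 , refl
sum-powers-odd t (suc k) with c , eq ← sum-powers-odd t k = c + t * (suc k + c * 2) , (begin
  sum (powers q (suc k))                   ≡⟨ sum-powers-suc q k ⟩
  1 + q * sum (powers q k)                 ≡⟨ cong (λ x → 1 + q * x) eq ⟩
  1 + (1 + t * 2) * (suc k + c * 2)        ≡⟨ arith t k c ⟩
  suc (suc k) + (c + t * (suc k + c * 2)) * 2 ∎)
  where
  open ≡-Reasoning
  q = 1 + t * 2
  arith : ∀ t k c → 1 + (1 + t * 2) * (suc k + c * 2) ≡ suc (suc k) + (c + t * (suc k + c * 2)) * 2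
  arith = solve-∀

module _ {p : ℕ} (p-prime : Prime p) where

  private instance
    p≢0 : NonZero p
    p≢0 = prime⇒nonZero p-prime

  ∤⇒coprime : ∀ {d} → ¬ p ∣ d → Coprime d p
  ∤⇒coprime p∤d (i∣d , i∣p) with prime⇒irreducible p-prime i∣p
  ... | inj₁ i≡1  = i≡1
  ... | inj₂ refl = contradiction i∣d p∤d

  ∈-powers⁺ : ∀ k {d} → d ∣ p ^ k → d ∈ powers p k
  ∈-powers⁺ zero    d∣1 = here (∣1⇒≡1 d∣1)
  ∈-powers⁺ (suc k) {d} d∣p^[1+k] with p ∣? d
  ... | no p∤d = here (coprime-^ʳ (∤⇒coprime p∤d) (suc k) (∣-refl , d∣p^[1+k]))
  ... | yes (divides e refl) =
    there (subst (_∈ map (p *_) (powers p k)) (*-comm p e) (∈-map⁺ (p *_) (∈-powers⁺ k e∣p^k)))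
    where
    e∣p^k : e ∣ p ^ k
    e∣p^k = *-cancelˡ-∣ p (subst (_∣ p ^ suc k) (*-comm e p) d∣p^[1+k])

  Unique-powers : ∀ k → Unique (powers p k)
  Unique-powers zero    = All.[] ∷ []
  Unique-powers (suc k) = All.tabulate 1∉ ∷ Unique.map⁺ (*-cancelˡ-≡ _ _ p) (Unique-powers k)
    where
    1∉ : ∀ {d} → d ∈ map (p *_) (powers p k) → 1 ≢ d
    1∉ d∈ 1≡d with ∈-map⁻ (p *_) d∈
    ... | e , _ , refl =
      nonTrivial⇒≢1 {{prime⇒nonTrivial p-prime}} (∣1⇒≡1 (subst (p ∣_) (sym 1≡d) (m∣m*n e)))

  σ[p^k]≡sum-powers : ∀ k → σ (p ^ k) ≡ sum (powers p k)
  σ[p^k]≡sum-powers k = σ≡sum {{m^n≢0 p k}} (Unique-powers k) (mk⇔ (∈-powers⁻ k) (∈-powers⁺ k))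

σ[p^k]-coprime : ∀ {p} k → Prime p → Coprime (σ (p ^ k)) p
σ[p^k]-coprime {p} k p-prime =
  subst (λ x → Coprime x p) (sym (σ[p^k]≡sum-powers p-prime k)) (sum-powers-coprime p k)

m%2≡1⇒m≡1+[m/2]*2 : ∀ {m} → m % 2 ≡ 1 → m ≡ 1 + m / 2 * 2
m%2≡1⇒m≡1+[m/2]*2 {m} m%2≡1 = trans (m≡m%n+[m/n]*n m 2) (cong (_+ m / 2 * 2) m%2≡1)

m%4≡1⇒m%2≡1 : ∀ m → m % 4 ≡ 1 → m % 2 ≡ 1
m%4≡1⇒m%2≡1 m m%4≡1 = trans (sym (m∣n⇒o%n%m≡o%m 2 4 m (divides 2 refl))) (cong (_% 2) m%4≡1)

σ[p^k]≡2*[1+s] : ∀ {p k} → Prime p → p % 2 ≡ 1 → k % 2 ≡ 1 → ∃[ s ] σ (p ^ k) ≡ 2 * suc s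
σ[p^k]≡2*[1+s] {p} {k} p-prime p%2≡1 k%2≡1 with c , eq ← sum-powers-odd (p / 2) k = k / 2 + c , (begin
  σ (p ^ k)                    ≡⟨ σ[p^k]≡sum-powers p-prime k ⟩
  sum (powers p k)             ≡⟨ cong (λ x → sum (powers x k)) (m%2≡1⇒m≡1+[m/2]*2 p%2≡1) ⟩
  sum (powers (1 + p / 2 * 2) k) ≡⟨ eq ⟩
  suc k + c * 2                ≡⟨ cong (λ x → suc x + c * 2) (m%2≡1⇒m≡1+[m/2]*2 k%2≡1) ⟩
  suc (1 + k / 2 * 2) + c * 2  ≡⟨ arith (k / 2) c ⟩
  2 * suc (k / 2 + c)          ∎)
  where
  open ≡-Reasoning
  arith : ∀ j c → suc (1 + j * 2) + c * 2 ≡ 2 * suc (j + c)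
  arith = solve-∀

σ[q^k]*σ[n^2]≡2*q^k*n^2 : ∀ {N} q k n → EulerianOPN N q k n →
                          σ (q ^ k) * σ (n ^ 2) ≡ 2 * (q ^ k * n ^ 2)
σ[q^k]*σ[n^2]≡2*q^k*n^2 {N} q k n (_ , perfect , N≡q^k*n^2 , _ , _ , _ , gcd[q,n]≡1) = begin
  σ (q ^ k) * σ (n ^ 2)  ≡⟨ σ-multiplicative q^k⊥n^2 ⟨
  σ (q ^ k * n ^ 2)      ≡⟨ cong σ N≡q^k*n^2 ⟨
  σ N                    ≡⟨ perfect ⟩
  2 * N                  ≡⟨ cong (2 *_) N≡q^k*n^2 ⟩
  2 * (q ^ k * n ^ 2)    ∎
  where
  open ≡-Reasoning
  q^k⊥n^2 : Coprime (q ^ k) (n ^ 2)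
  q^k⊥n^2 = coprime-^ˡ (coprime-^ʳ (Coprime.gcd≡1⇒coprime gcd[q,n]≡1) 2) k

s*X≡Q*n^2⇒gcd-formulas : ∀ {s Q n X} .{{_ : NonZero s}} → s * X ≡ Q * n ^ 2 →
  Coprime s Q → Coprime n Q → Coprime X 2 →
  gcd n X ≡ n * gcd s n / s × gcd (2 * s) X ≡ gcd s n ^ 2 / s
s*X≡Q*n^2⇒gcd-formulas {s} {Q} {n} {X} s*X≡Q*n^2 s⊥Q n⊥Q X⊥2
  with m , s*m≡n^2 , X≡Q*m ← coprime∧*≡*⇒∃ s⊥Q s*X≡Q*n^2 =
  (begin
    gcd n X        ≡⟨ cong (gcd n) X≡Q*m ⟩
    gcd n (Q * m)  ≡⟨ gcd[m,n*o]≡gcd[m,o] m n⊥Q ⟩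
    gcd n m        ≡⟨ gcd[n,m]≡n*gcd[s,n]/s {n = n} s*m≡n^2 ⟩
    n * gcd s n / s ∎) ,
  (begin
    gcd (2 * s) X  ≡⟨ gcd-comm (2 * s) X ⟩
    gcd X (2 * s)  ≡⟨ gcd[m,n*o]≡gcd[m,o] s X⊥2 ⟩
    gcd X s        ≡⟨ gcd-comm X s ⟩
    gcd s X        ≡⟨ cong (gcd s) X≡Q*m ⟩
    gcd s (Q * m)  ≡⟨ gcd[m,n*o]≡gcd[m,o] m s⊥Q ⟩
    gcd s m        ≡⟨ gcd[s,m]≡gcd[s,n]^2/s {n = n} s*m≡n^2 ⟩
    gcd s n ^ 2 / s ∎)
  where open ≡-Reasoning

[2*m]÷2≡m : ∀ m → (2 * m) ÷ 2 ≡ m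
[2*m]÷2≡m m = trans (cong (_/ 2) (*-comm 2 m)) (m*n/n≡m m 2)

gcd-formulas-in-A÷2 : ∀ {A s n X} → A ≡ 2 * suc s →
  gcd n X ≡ n * gcd (suc s) n / suc s × gcd (2 * suc s) X ≡ gcd (suc s) n ^ 2 / suc s →
  gcd n X ≡ (n * gcd (A ÷ 2) n) ÷ (A ÷ 2) × gcd A X ≡ (gcd (A ÷ 2) n ^ 2) ÷ (A ÷ 2)
gcd-formulas-in-A÷2 {s = s} refl rewrite [2*m]÷2≡m (suc s) = id

lemma4 : (N q k n : ℕ) → EulerianOPN N q k n →
    gcd n (σ (n ^ 2)) ≡ (n * gcd (σ (q ^ k) ÷ 2) n) ÷ (σ (q ^ k) ÷ 2)
    × gcd (σ (q ^ k)) (σ (n ^ 2)) ≡ (gcd (σ (q ^ k) ÷ 2) n ^ 2) ÷ (σ (q ^ k) ÷ 2)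
lemma4 N q k n opn@(N-odd , _ , N≡q^k*n^2 , q-prime , q%4≡1 , k%4≡1 , gcd[q,n]≡1)
  with s′ , σ[q^k]≡2*s ← σ[p^k]≡2*[1+s] {k = k} q-prime
                            (m%4≡1⇒m%2≡1 q q%4≡1) (m%4≡1⇒m%2≡1 k k%4≡1)
  = gcd-formulas-in-A÷2 {n = n} {X = X} σ[q^k]≡2*s
      (s*X≡Q*n^2⇒gcd-formulas s*X≡q^k*n^2 s⊥q^k n⊥q^k X⊥2)
  where
  s = suc s′
  X = σ (n ^ 2)
  s*X≡q^k*n^2 : s * X ≡ q ^ k * n ^ 2
  s*X≡q^k*n^2 = *-cancelˡ-≡ (s * X) (q ^ k * n ^ 2) 2 (begin
    2 * (s * X)          ≡⟨ *-assoc 2 s X ⟨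
    2 * s * X            ≡⟨ cong (_* X) σ[q^k]≡2*s ⟨
    σ (q ^ k) * X        ≡⟨ σ[q^k]*σ[n^2]≡2*q^k*n^2 q k n opn ⟩
    2 * (q ^ k * n ^ 2)  ∎)
    where open ≡-Reasoning
  s⊥q^k : Coprime s (q ^ k)
  s⊥q^k = coprime-^ʳ (coprime-∣ˡ 2*s⊥q (n∣m*n 2)) k
    where
    2*s⊥q : Coprime (2 * s) q
    2*s⊥q = subst (λ x → Coprime x q) σ[q^k]≡2*s (σ[p^k]-coprime k q-prime)
  n⊥q^k : Coprime n (q ^ k)
  n⊥q^k = coprime-^ʳ (Coprime.sym (Coprime.gcd≡1⇒coprime gcd[q,n]≡1)) k
  X⊥2 : Coprime X 2
  X⊥2 = coprime-∣ˡ (m%n≡1⇒coprime N-odd) (divides s (trans N≡q^k*n^2 (sym s*X≡q^k*n^2)))
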